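{- Let $A=(\Sigma,G,\mathcal I)$ and $A'=(\Sigma',G',\mathcal I')$ be interactive proto-algorithms with $\mathcal I=(D,D_{\mathrm{in}},D_{\mathrm{out}},I)$ and $\mathcal I'=(D',D'_{\mathrm{in}},D'_{\mathrm{out}},I')$. If $A$ is algorithmically simulated by $A'$, then there exist total functions $f_I\colon D_{\mathrm{in}}\to D'_{\mathrm{in}}$ and $f_O\colon D'_{\mathrm{out}}\to D_{\mathrm{out}}$ such that, writing $f_I^\infty$ and $f_O^\infty$ for their pointwise extensions to sequences: (1) for all non-empty finite or countably infinite sequences $\delta_{\mathrm{in}}$ over $D_{\mathrm{in}}$ and $\delta_{\mathrm{out}}$ over $D_{\mathrm{out}}$, if $(\delta_{\mathrm{in}},\delta_{\mathrm{out}})\in\widehat A$ then there exists a non-empty finite or countably infinite sequence $\delta'_{\mathrm{out}}$ over $D'_{\mathrm{out}}$ with $(f_I^\infty(\delta_{\mathrm{in}}),\delta'_{\mathrm{out}})\in\widehat{A'}$ and $f_O^\infty(\delta'_{\mathrm{out}})=\delta_{\mathrm{out}}$; (2) for every non-empty finite sequence $\delta_{\mathrm{in}}$ over $D_{\mathrm{in}}$ and every convergent $\sigma\in\mathrm{arun}_A(\delta_{\mathrm{in}})$, there exists a convergent $\sigma'\in\mathrm{arun}_{A'}(f_I^\infty(\delta_{\mathrm{in}}))$ with $f_O^\infty(\mathrm{outputs}_{A'}(\sigma'))=\mathrm{outputs}_A(\sigma)$ and $|\sigma|=|\sigma'|$.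
   Context: A rooted labeled directed graph is $(V,E,L_v,L_e,l,r)$ with $V$ non-empty finite, $E\subseteq V\times V$, $L_v,L_e$ countable, $l$ a partial function on $V\cup E$ sending vertices into $L_v$ and edges into $L_e$, root $r\in V$. A cycle is $v_1\ldots v_{n+1}$ with consecutive pairs in $E$, $v_1,\dots,v_n$ distinct, $v_1=v_{n+1}$. A set $\mathcal A$ is finitely generated if there are a finite $\mathcal A'\subseteq\mathcal A$ and finitely many functions on $\mathcal A$ such that every $\mathcal A''$ with $\mathcal A'\subseteq\mathcal A''\subseteq\mathcal A$ has closure under them equal to $\mathcal A$. Sequences are non-empty finite or countably infinite unless said otherwise; $\langle\rangle$ is the empty sequence, $\frown$ concatenation, $|\sigma|$ the length, $\sigma[n]$ the $n$th element (or last element if shorter). An interactive alphabet is $\Sigma=(F,P)$, $F,P$ disjoint countable, $\mathsf{ini},\mathsf{fin},\mathsf{inp},\mathsf{outp}\in F$; $\widetilde F=F\setminus\{\mathsf{ini},\mathsf{fin},\mathsf{inp},\mathsf{outp}\}$. An interactive $\Sigma$-algorithm graph is $(V,E,L_v,L_e,l,r)$ with $L_v=F\cup P$, $L_e=\{0,1\}$ and: $\mathrm{indeg}(v)=0$ iff $v=r$; $l(v)=\mathsf{ini}$ iff $\mathrm{indeg}(v)=0$; $l(v)=\mathsf{fin}$ iff $\mathrm{outdeg}(v)=0$; $l(v)=\mathsf{outp}$ implies $\mathrm{outdeg}(v)=1$; outgoing edges of $F$-labeled vertices are unlabeled; $P$-labeled vertices have out-degree 2 with defined distinct edge labels; for $(v,v')\in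 E$, $l(v)=\mathsf{outp}$ iff $l(v')=\mathsf{inp}$; every cycle contains an $F$-labeled vertex. An interactive $\Sigma$-interpretation $(D,D_{\mathrm{in}},D_{\mathrm{out}},I)$: $D$ a set, $D_{\mathrm{in}},D_{\mathrm{out}}$ finitely generated, total computable $I(\mathsf{ini})\colon D_{\mathrm{in}}\to D$, $I(\mathsf{fin})\colon D\to D_{\mathrm{out}}$, $I(\mathsf{inp})\colon D\times D_{\mathrm{in}}\to D$, $I(\mathsf{outp})\colon D\to D_{\mathrm{out}}$, $I(f)\colon D\to D$ ($f\in\widetilde F$), $I(p)\colon D\to\{0,1\}$; no proper subset of $D$ contains the image of $I(\mathsf{ini})$ and is closed under all $I(f)$, $f\in\widetilde F$, and under all $d\mapsto I(\mathsf{inp})(d,d_{\mathrm{in}})$. An interactive proto-algorithm is $A=(\Sigma,G,\mathcal I)$ with $G=(V,E,L_v,L_e,l,r)$. With a dummy $\bot$ outside $V,D,D_{\mathrm{in}},D_{\mathrm{out}}$, a state is $(d_{\mathrm{in}},(v,d),d_{\mathrm{out}})$ with $d_{\mathrm{in}}\in D_{\mathrm{in}}\cup\{\bot\}$, $v\in V\cup\{\bot\}$, $d\in D\cup\{\bot\}$, $d_{\mathrm{out}}\in D_{\mathrm{out}}\cup\{\bot\}$ and: $v=\bot$ iff $d=\bot$; if $(v,d)=(\bot,\bot)$ then $d_{\mathrm{in}}=\bot$ iff $d_{\mathrm{out}}\ne\bot$; if $(v,d)\neq(\bot,\bot)$ then $d_{\mathrm{in}}=\bot$ iff $d_{\mathrm{out}}=\bot$;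 if $d_{\mathrm{in}}=d_{\mathrm{out}}=\bot$ then $l(v)\ne\mathsf{inp}$; if both are $\ne\bot$ then $l(v)=\mathsf{inp}$. Kinds: initial $D_{\mathrm{in}}\times\{(\bot,\bot)\}\times\{\bot\}$; final $\{\bot\}\times\{(\bot,\bot)\}\times D_{\mathrm{out}}$; internal $\{\bot\}\times(V\times D)\times\{\bot\}$; interaction $D_{\mathrm{in}}\times(V\times D)\times D_{\mathrm{out}}$. $\mathcal S_A$ is the set of states. $\mathrm{astep}_A$ is the smallest (pointwise under inclusion) total function $\mathcal S_A\to$ non-empty subsets of $\mathcal S_A$ with: $(\bot,(v',d),\bot)\in\mathrm{astep}_A((d_{\mathrm{in}},(\bot,\bot),\bot))$ if $l(r)=\mathsf{ini}$, $(r,v')\in E$, $I(\mathsf{ini})(d_{\mathrm{in}})=d$; $(\bot,(v',d'),\bot)\in\mathrm{astep}_A((\bot,(v,d),\bot))$ if $l(v)\in\widetilde F$, $(v,v')\in E$, $I(l(v))(d)=d'$; $(\bot,(v',d),\bot)\in\mathrm{astep}_A((\bot,(v,d),\bot))$ if $l(v)\in P$, $(v,v')\in E$, $I(l(v))(d)=l((v,v'))$; $(d_{\mathrm{in}},(v',d),d_{\mathrm{out}})\in\mathrm{astep}_A((\bot,(v,d),\bot))$ if $l(v)=\mathsf{outp}$, $(v,v')\in E$, $I(\mathsf{outp})(d)=d_{\mathrm{out}}$; $(\bot,(v',d'),\bot)\in\mathrm{astep}_A((d_{\mathrm{in}},(v,d),d_{\mathrm{out}}))$ if $l(v)=\mathsf{inp}$,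 $(v,v')\in E$, $I(\mathsf{inp})(d,d_{\mathrm{in}})=d'$; $(\bot,(\bot,\bot),d_{\mathrm{out}})\in\mathrm{astep}_A((\bot,(v,d),\bot))$ if $l(v)=\mathsf{fin}$, $I(\mathsf{fin})(d)=d_{\mathrm{out}}$; $(\bot,(\bot,\bot),d_{\mathrm{out}})\in\mathrm{astep}_A((\bot,(\bot,\bot),d_{\mathrm{out}}))$. $\mathrm{asruns}_A(s)=\{\langle s\rangle\frown\tau:\exists s'\in\mathrm{astep}_A(s),\tau\in\mathrm{asruns}_A(s')\}$ for non-final $s$ and $\{\langle s\rangle\}$ for final $s$ (including infinite sequences); elements are algorithmic semi-runs; divergent if some suffix consists only of internal states, convergent otherwise. For convergent semi-runs: $\mathrm{inputs}_A(\langle(d_{\mathrm{in}},c,d_{\mathrm{out}})\rangle\frown\tau)=\langle d_{\mathrm{in}}\rangle\frown\mathrm{inputs}_A(\tau)$ if $\tau\ne\langle\rangle$, $d_{\mathrm{in}}\ne\bot$; $=\mathrm{inputs}_A(\tau)$ if $\tau\ne\langle\rangle$, $d_{\mathrm{in}}=\bot$; $=\langle\rangle$ if $\tau=\langle\rangle$. $\mathrm{outputs}_A(\langle(d_{\mathrm{in}},c,d_{\mathrm{out}})\rangle\frown\tau)=\langle d_{\mathrm{out}}\rangle\frown\mathrm{outputs}_A(\tau)$ if $\tau\neq\langle\rangle$, $d_{\mathrm{out}}\ne\bot$; $=\mathrm{outputs}_A(\tau)$ if $\tau\ne\langle\rangle$, $d_{\mathrm{out}}=\bot$; $=\langle d_{\mathrm{out}}\rangle$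 if $\tau=\langle\rangle$. $\mathrm{arun}_A(\delta)$ is the set of $\sigma\in\mathrm{asruns}_A((\delta[1],(\bot,\bot),\bot))$ with $\mathrm{inputs}_A(\sigma)=\delta$. The relation $\widehat A$ computed by $A$: $(\delta_{\mathrm{in}},\delta_{\mathrm{out}})\in\widehat A$ iff there is a convergent $\sigma\in\mathrm{arun}_A(\delta_{\mathrm{in}})$ with $\delta_{\mathrm{out}}=\mathrm{outputs}_A(\sigma)$. An algorithmic simulation of $A$ by $A'$ is $R\subseteq\mathcal S_A\times\mathcal S_{A'}$ such that: every initial state of $A$ is related to some initial state of $A'$; every final state of $A'$ is related (as second component) to some final state of $A$; if $(s,s')\in R$ and $t\in\mathrm{astep}_A(s)$ there is $t'\in\mathrm{astep}_{A'}(s')$ with $(t,t')\in R$; for $(s,s')\in R$, $s$ is initial iff $s'$ is, $s$ is final iff $s'$ is, $s$ is internal iff $s'$ is; and there exist total $g_I\colon D_{\mathrm{in}}\to D'_{\mathrm{in}}$, $g_O\colon D'_{\mathrm{out}}\to D_{\mathrm{out}}$ with, for all $((d_{\mathrm{in}},c,d_{\mathrm{out}}),(d'_{\mathrm{in}},c',d'_{\mathrm{out}}))\in R$: $d'_{\mathrm{in}}=g_I(d_{\mathrm{in}})$ whenever $d_{\mathrm{in}}\ne\bot$ or $d'_{\mathrm{in}}\ne\bot$, and $d_{\mathrm{out}}=g_O(d'_{\mathrm{out}})$ whenever $d_{\mathrm{out}}\ne\bot$ or $d'_{\mathrm{out}}\ne\bot$. $A$ is algorithmically simulated by $A'$ if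 such an $R$ exists. -}

module Defs where

open import Level using (0ℓ)
open import Data.Nat using (ℕ; zero; suc; _<_; _≤_)
open import Data.Fin using (Fin) renaming (_<_ to _<ᶠ_)
open import Data.Bool using (Bool; T; if_then_else_)
open import Data.Maybe using (Maybe; just; nothing)
open import Data.List using (List; []; _∷_; _++_; [_]; length; map; allFin; lookup)
open import Data.Nat.ListAction using (sum)
open import Data.List.Relation.Unary.Any using (Any)
open import Data.List.Relation.Unary.All using (All)
open import Data.List.Relation.Unary.Unique.Propositional using (Unique)
open import Data.List.Relation.Unary.Linked using (Linked)
open import Data.Product using (Σ; ∃; _×_; _,_)
open import Data.Sum using (_⊎_; inj₁; inj₂)
open import Data.Empty using (⊥)
open import Data.Unit using (⊤)
open import Relation.Nullary using (¬_)
open import Relation.Unary using (Pred; _∈_)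
open import Relation.Binary.PropositionalEquality using (_≡_; _≢_)
open import Function.Definitions using (Injective)
open import Function.Bundles using (_⇔_)

-- countable = finite or countably infinite = injects into ℕ
Countable : Set → Set
Countable X = Σ (X → ℕ) (λ c → Injective _≡_ _≡_ c)

data Closure {A : Set} {k : ℕ} (arity : Fin k → ℕ)
             (op : (i : Fin k) → (Fin (arity i) → A) → A)
             (S : Pred A 0ℓ) : Pred A 0ℓ where
  base : ∀ {a} → S a → Closure arity op S a
  apply : ∀ i (args : Fin (arity i) → A) →
          (∀ j → Closure arity op S (args j)) → Closure arity op S (op i args)

record FinGen (A : Set) : Set₁ where
  field
    gens  : List A
    k     : ℕ
    arity : Fin k → ℕ
    op    : (i : Fin k) → (Fin (arity i) → A) → A
    generates : ∀ (S : Pred A 0ℓ) →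
                (∀ a → Any (a ≡_) gens → S a) →
                ∀ a → Closure arity op S a

-- sequences: non-empty finite (first element and the rest) or countably infinite
data Seq (X : Set) : Set where
  finSeq : X → List X → Seq X
  infSeq : (ℕ → X) → Seq X

mapSeq : {X Y : Set} → (X → Y) → Seq X → Seq Y
mapSeq f (finSeq x xs) = finSeq (f x) (map f xs)
mapSeq f (infSeq g) = infSeq (λ n → f (g n))

headSeq : {X : Set} → Seq X → X
headSeq (finSeq x _) = x
headSeq (infSeq g) = g 0

_≈ˢ_ : {X : Set} → Seq X → Seq X → Set
finSeq x xs ≈ˢ finSeq y ys = _≡_ {A = List _} (x ∷ xs) (y ∷ ys)
finSeq _ _ ≈ˢ infSeq _ = ⊥
infSeq _ ≈ˢ finSeq _ _ = ⊥
infSeq f ≈ˢ infSeq g = ∀ n → f n ≡ g n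

-- |σ| = |σ'| (infinite sequences have length ω)
SameLength : {X Y : Set} → Seq X → Seq Y → Set
SameLength (finSeq _ xs) (finSeq _ ys) = length xs ≡ length ys
SameLength (finSeq _ _) (infSeq _) = ⊥
SameLength (infSeq _) (finSeq _ _) = ⊥
SameLength (infSeq _) (infSeq _) = ⊤

-- δ is the sequence of the defined (non-⊥) entries of x, in order
Filter : {X : Set} → (ℕ → Maybe X) → Seq X → Set
Filter x (infSeq g) =
  Σ (ℕ → ℕ) λ h → (∀ i j → i < j → h i < h j)
                × (∀ k → x (h k) ≡ just (g k))
                × (∀ m → (∀ k → h k ≢ m) → x m ≡ nothing)
Filter {X} x (finSeq a as) =
  Σ (Fin (length (a ∷ as)) → ℕ) λ h → (∀ i j → i <ᶠ j → h i < h j)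
                × (∀ k → x (h k) ≡ just (lookup (a ∷ as) k))
                × (∀ m → (∀ k → h k ≢ m) → x m ≡ nothing)

maybeCons : {X : Set} → Maybe X → List X → List X
maybeCons nothing l = l
maybeCons (just x) l = x ∷ l

record Alphabet : Set₁ where
  field
    F P : Set
    F-countable : Countable F
    P-countable : Countable P
    ini fin inp outp : F

F̃ : (Σ' : Alphabet) → Alphabet.F Σ' → Set
F̃ Σ' f = f ≢ ini × f ≢ fin × f ≢ inp × f ≢ outp
  where open Alphabet Σ'

indeg : {n : ℕ} → (Fin n → Fin n → Bool) → Fin n → ℕ
indeg {n} E v = sum (map (λ u → if E u v then 1 else 0) (allFin n))

outdeg : {n : ℕ} → (Fin n → Fin n → Bool) → Fin n → ℕ
outdeg {n} E v = sum (map (λ u → if E v u then 1 else 0) (allFin n))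

IsCycle : {n : ℕ} → (Fin n → Fin n → Bool) → List (Fin n) → Set
IsCycle E [] = ⊥
IsCycle E (v ∷ vs) = Unique (v ∷ vs) × Linked (λ a b → T (E a b)) (v ∷ vs ++ [ v ])

record AlgGraph (Σ' : Alphabet) : Set where
  open Alphabet Σ'
  field
    n  : ℕ
    E  : Fin n → Fin n → Bool
    lv : Fin n → Maybe (F ⊎ P)
    le : Fin n → Fin n → Maybe Bool
    r  : Fin n
    le-edges    : ∀ u v → ¬ T (E u v) → le u v ≡ nothing
    indeg-root  : ∀ v → (indeg E v ≡ 0) ⇔ (v ≡ r)
    ini-label   : ∀ v → (lv v ≡ just (inj₁ ini)) ⇔ (indeg E v ≡ 0)
    fin-label   : ∀ v → (lv v ≡ just (inj₁ fin)) ⇔ (outdeg E v ≡ 0)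
    outp-outdeg : ∀ v → lv v ≡ just (inj₁ outp) → outdeg E v ≡ 1
    F-unlabeled : ∀ v v' f → lv v ≡ just (inj₁ f) → T (E v v') → le v v' ≡ nothing
    P-outdeg    : ∀ v p → lv v ≡ just (inj₂ p) → outdeg E v ≡ 2
    P-labeled   : ∀ v v' p → lv v ≡ just (inj₂ p) → T (E v v') → ∃ λ b → le v v' ≡ just b
    P-distinct  : ∀ v v₁ v₂ p → lv v ≡ just (inj₂ p) → T (E v v₁) → T (E v v₂) →
                  le v v₁ ≡ le v v₂ → v₁ ≡ v₂
    outp-inp    : ∀ v v' → T (E v v') → (lv v ≡ just (inj₁ outp)) ⇔ (lv v' ≡ just (inj₁ inp))
    cycles      : ∀ c → IsCycle E c → Any (λ v → ∃ λ f → lv v ≡ just (inj₁ f)) c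

record Interp (Σ' : Alphabet) : Set₁ where
  open Alphabet Σ'
  field
    D Din Dout : Set
    Din-fg  : FinGen Din
    Dout-fg : FinGen Dout
    I-ini  : Din → D
    I-fin  : D → Dout
    I-inp  : D → Din → D
    I-outp : D → Dout
    I-f    : F → D → D          -- I(f) for f ∈ F̃ (values for f ∉ F̃ are never used)
    I-p    : P → D → Bool
    minimal : ∀ (S : Pred D 0ℓ) →
              (∀ x → S (I-ini x)) →
              (∀ f → F̃ Σ' f → ∀ d → S d → S (I-f f d)) →
              (∀ x d → S d → S (I-inp d x)) →
              ∀ d → S d

record ProtoAlg : Set₁ where
  field
    Σₐ : Alphabet
    G  : AlgGraph Σₐ
    𝓘  : Interp Σₐ

module _ (A : ProtoAlg) where
  open ProtoAlg A
  open Alphabet Σₐ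
  open AlgGraph G
  open Interp 𝓘

  data State : Set where
    initialS     : Din → State                                      -- (d_in,(⊥,⊥),⊥)
    finalS       : Dout → State                                     -- (⊥,(⊥,⊥),d_out)
    internalS    : (v : Fin n) → D → lv v ≢ just (inj₁ inp) → State  -- (⊥,(v,d),⊥)
    interactionS : Din → (v : Fin n) → D → Dout →
                   lv v ≡ just (inj₁ inp) → State                    -- (d_in,(v,d),d_out)

  dinOf : State → Maybe Din
  dinOf (initialS x) = just x
  dinOf (finalS _) = nothing
  dinOf (internalS _ _ _) = nothing
  dinOf (interactionS x _ _ _ _) = just x

  doutOf : State → Maybe Dout
  doutOf (initialS _) = nothing
  doutOf (finalS y) = just y
  doutOf (internalS _ _ _) = nothing
  doutOf (interactionS _ _ _ y _) = just y

  IsInitial IsFinal IsInternal : State → Set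
  IsInitial (initialS _) = ⊤
  IsInitial _ = ⊥
  IsFinal (finalS _) = ⊤
  IsFinal _ = ⊥
  IsInternal (internalS _ _ _) = ⊤
  IsInternal _ = ⊥

  data AStep : State → State → Set where
    st-ini  : ∀ {x v' d} {q'} → lv r ≡ just (inj₁ ini) → T (E r v') → I-ini x ≡ d →
              AStep (initialS x) (internalS v' d q')
    st-f    : ∀ {v v' d d' f} {q q'} → F̃ Σₐ f → lv v ≡ just (inj₁ f) → T (E v v') →
              I-f f d ≡ d' → AStep (internalS v d q) (internalS v' d' q')
    st-p    : ∀ {v v' d p} {q q'} → lv v ≡ just (inj₂ p) → T (E v v') →
              le v v' ≡ just (I-p p d) → AStep (internalS v d q) (internalS v' d q')
    st-outp : ∀ {v v' d x y} {q q'} → lv v ≡ just (inj₁ outp) → T (E v v') →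
              I-outp d ≡ y → AStep (internalS v d q) (interactionS x v' d y q')
    st-inp  : ∀ {v v' d d' x y} {q q'} → lv v ≡ just (inj₁ inp) → T (E v v') →
              I-inp d x ≡ d' → AStep (interactionS x v d y q) (internalS v' d' q')
    st-fin  : ∀ {v d y} {q} → lv v ≡ just (inj₁ fin) → I-fin d ≡ y →
              AStep (internalS v d q) (finalS y)
    st-stay : ∀ {y} → AStep (finalS y) (finalS y)

  -- ⟨s⟩ ⌢ τ ∈ asruns_A(s) for finite τ
  FinRun : State → List State → Set
  FinRun s [] = IsFinal s
  FinRun s (t ∷ τ) = ¬ IsFinal s × AStep s t × FinRun t τ

  IsSemiRun : State → Seq State → Set
  IsSemiRun s (finSeq s₀ τ) = s₀ ≡ s × FinRun s₀ τ
  IsSemiRun s (infSeq σ) = σ 0 ≡ s × (∀ i → ¬ IsFinal (σ i) × AStep (σ i) (σ (suc i)))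

  -- some (non-empty) suffix consists only of internal states
  DivergentL : State → List State → Set
  DivergentL s [] = IsInternal s
  DivergentL s (t ∷ τ) = (IsInternal s × All IsInternal (t ∷ τ)) ⊎ DivergentL t τ

  Divergent : Seq State → Set
  Divergent (finSeq s τ) = DivergentL s τ
  Divergent (infSeq σ) = ∃ λ i → ∀ j → i ≤ j → IsInternal (σ j)

  Convergent : Seq State → Set
  Convergent σ = ¬ Divergent σ

  inputsL : State → List State → List Din
  inputsL s [] = []
  inputsL s (t ∷ τ) = maybeCons (dinOf s) (inputsL t τ)

  outputsL : State → List State → List Dout
  outputsL s [] = maybeCons (doutOf s) []
  outputsL s (t ∷ τ) = maybeCons (doutOf s) (outputsL t τ)

  Inputs : Seq State → Seq Din → Set
  Inputs (finSeq s τ) (finSeq x xs) = inputsL s τ ≡ x ∷ xs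
  Inputs (finSeq s τ) (infSeq _) = ⊥
  Inputs (infSeq σ) δ = Filter (λ i → dinOf (σ i)) δ

  Outputs : Seq State → Seq Dout → Set
  Outputs (finSeq s τ) (finSeq y ys) = outputsL s τ ≡ y ∷ ys
  Outputs (finSeq s τ) (infSeq _) = ⊥
  Outputs (infSeq σ) δ = Filter (λ i → doutOf (σ i)) δ

  ARun : Seq Din → Seq State → Set
  ARun δ σ = IsSemiRun (initialS (headSeq δ)) σ × Inputs σ δ

  Computes : Seq Din → Seq Dout → Set
  Computes δin δout = ∃ λ σ → ARun δin σ × Convergent σ × Outputs σ δout

record AlgSimulation (A A' : ProtoAlg) : Set₁ where
  field
    R : State A → State A' → Set
    init-rel  : ∀ x → ∃ λ s' → IsInitial A' s' × R (initialS x) s'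
    final-rel : ∀ s' → IsFinal A' s' → ∃ λ s → IsFinal A s × R s s'
    step-rel  : ∀ s s' → R s s' → ∀ t → AStep A s t → ∃ λ t' → AStep A' s' t' × R t t'
    kind-initial  : ∀ s s' → R s s' → IsInitial A s ⇔ IsInitial A' s'
    kind-final    : ∀ s s' → R s s' → IsFinal A s ⇔ IsFinal A' s'
    kind-internal : ∀ s s' → R s s' → IsInternal A s ⇔ IsInternal A' s'
    gI : Interp.Din (ProtoAlg.𝓘 A) → Interp.Din (ProtoAlg.𝓘 A')
    gO : Interp.Dout (ProtoAlg.𝓘 A') → Interp.Dout (ProtoAlg.𝓘 A)
    gI-rel : ∀ s s' → R s s' → (dinOf A s ≢ nothing ⊎ dinOf A' s' ≢ nothing) →
             ∃ λ x → dinOf A s ≡ just x × dinOf A' s' ≡ just (gI x)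
    gO-rel : ∀ s s' → R s s' → (doutOf A s ≢ nothing ⊎ doutOf A' s' ≢ nothing) →
             ∃ λ y → doutOf A' s' ≡ just y × doutOf A s ≡ just (gO y)

SimulatedBy : ProtoAlg → ProtoAlg → Set₁
SimulatedBy A A' = AlgSimulation A A'

-- A simulation relation lifts a run of A step by step to a run of A' with
-- pointwise related states, hence of the same length.  Relatedness forces the
-- inputs of the lifted run to be the gI-images of the original ones, the
-- original outputs to be the gO-images of the lifted ones, and preserves the
-- kind of every state, hence convergence.  In part (2) the run is finite: an
-- infinite run reading finitely many inputs is eventually internal, i.e.
-- divergent.
module Submission where

open import Defs
open import Data.List using (List)
open import Data.Product using (Σ; ∃; _×_)

open import Data.Nat using (ℕ; zero; suc; _<_; _≤_; s≤s)
open import Data.Nat.Properties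
  using (≤-trans; ≤-reflexive; <⇒≤; <-irrefl; m≤n⇒m<n∨m≡n; suc-injective)
open import Data.Fin using (Fin; cast; fromℕ) renaming (_<_ to _<ᶠ_; zero to fzero; suc to fsuc)
open import Data.Fin.Properties using (toℕ-cast; cast-involutive; ≤fromℕ; toℕ-injective)
open import Data.List using ([]; _∷_; map; length; lookup; tabulate)
open import Data.List.Properties
  using (length-map; length-tabulate; lookup-tabulate; map-tabulate; tabulate-cong; tabulate-lookup)
open import Data.List.Relation.Binary.Pointwise using (Pointwise; []; _∷_; Pointwise-length)
open import Data.List.Relation.Unary.All using (All; []; _∷_)
open import Data.Maybe using (Maybe; just; nothing) renaming (map to mapMaybe)
open import Data.Maybe.Properties using (just-injective)
open import Data.Product using (_,_; proj₁; proj₂; ∃₂)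
open import Data.Sum using (_⊎_; inj₁; inj₂; swap)
open import Data.Empty using (⊥-elim)
open import Data.Unit using (tt)
open import Function using (_∘_)
open import Function.Bundles using (Equivalence)
open import Relation.Nullary using (¬_)
open import Relation.Binary.PropositionalEquality
open Equivalence using (to; from)

module _ {X Y : Set} (f : X → Y) where

  mapMaybe-≡-just : ∀ {m b} → mapMaybe f m ≡ just b → ∃ λ a → m ≡ just a × f a ≡ b
  mapMaybe-≡-just {just a} refl = a , refl , refl
  mapMaybe-≡-just {nothing} ()

  mapMaybe-≡-nothing : ∀ {m} → mapMaybe f m ≡ nothing → m ≡ nothing
  mapMaybe-≡-nothing {nothing} refl = refl
  mapMaybe-≡-nothing {just _} ()

  ≡-mapMaybe : ∀ {m m'} →
    (m ≢ nothing ⊎ m' ≢ nothing → ∃ λ a → m ≡ just a × m' ≡ just (f a)) →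
    m' ≡ mapMaybe f m
  ≡-mapMaybe {just a} related with related (inj₁ λ ())
  ... | _ , refl , m'≡fa = m'≡fa
  ≡-mapMaybe {nothing} {nothing} related = refl
  ≡-mapMaybe {nothing} {just _} related with related (inj₂ λ ())
  ... | _ , () , _

  maybeCons-map : ∀ m l → maybeCons (mapMaybe f m) (map f l) ≡ map f (maybeCons m l)
  maybeCons-map nothing l = refl
  maybeCons-map (just a) l = refl

  lookup-map : ∀ (l : List X) k → lookup (map f l) (cast (sym (length-map f l)) k) ≡ f (lookup l k)
  lookup-map (a ∷ l) fzero = refl
  lookup-map (a ∷ l) (fsuc k) = lookup-map l k

headSeq-mapSeq : ∀ {X Y : Set} (f : X → Y) δ → headSeq (mapSeq f δ) ≡ f (headSeq δ)
headSeq-mapSeq f (finSeq _ _) = refl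
headSeq-mapSeq f (infSeq _) = refl

-- Filter x (infSeq g) is FilterBy _<_ x g and Filter x (finSeq a as) is
-- FilterBy _<ᶠ_ x (lookup (a ∷ as)), both by definition.
FilterBy : {K X : Set} → (K → K → Set) → (ℕ → Maybe X) → (K → X) → Set
FilterBy {K} _≺_ x v =
  Σ (K → ℕ) λ h → (∀ i j → i ≺ j → h i < h j)
                × (∀ k → x (h k) ≡ just (v k))
                × (∀ m → (∀ k → h k ≢ m) → x m ≡ nothing)

module _ {K X Y : Set} {_≺_ : K → K → Set} where

  FilterBy-map : (f : X → Y) {x : ℕ → Maybe X} {x' : ℕ → Maybe Y} →
    (∀ i → x' i ≡ mapMaybe f (x i)) →
    ∀ {v} → FilterBy _≺_ x v → FilterBy _≺_ x' (f ∘ v)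
  FilterBy-map f x'≡fx (h , mono , values , gaps) =
    h , mono ,
    (λ k → trans (x'≡fx (h k)) (cong (mapMaybe f) (values k))) ,
    (λ m missed → trans (x'≡fx m) (cong (mapMaybe f) (gaps m missed)))

  FilterBy-unmap : (g : Y → X) {y : ℕ → Maybe X} {y' : ℕ → Maybe Y} →
    (∀ i → y i ≡ mapMaybe g (y' i)) →
    ∀ {v} → FilterBy _≺_ y v → ∃ λ v' → FilterBy _≺_ y' v' × (∀ k → g (v' k) ≡ v k)
  FilterBy-unmap g {y} {y'} y≡gy' {v} (h , mono , values , gaps) =
    proj₁ ∘ preimage ,
    (h , mono , proj₁ ∘ proj₂ ∘ preimage ,
     λ m missed → mapMaybe-≡-nothing g (trans (sym (y≡gy' m)) (gaps m missed))) ,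
    proj₂ ∘ proj₂ ∘ preimage
    where
    preimage : ∀ k → ∃ λ b → y' (h k) ≡ just b × g b ≡ v k
    preimage k = mapMaybe-≡-just g (trans (sym (y≡gy' (h k))) (values k))

FilterBy-cast : ∀ {X : Set} {m n} {x : ℕ → Maybe X} {v : Fin m → X} {w : Fin n → X} →
  (e : m ≡ n) → (∀ k → w (cast e k) ≡ v k) → FilterBy _<ᶠ_ x v → FilterBy _<ᶠ_ x w
FilterBy-cast {m = m} {n} {x} {v} {w} e w∘cast≗v (h , mono , values , gaps) =
  h ∘ back , mono' , values' , gaps'
  where
  back : Fin n → Fin m
  back = cast (sym e)

  mono' : ∀ i j → i <ᶠ j → h (back i) < h (back j)
  mono' i j i<j = mono (back i) (back j)
    (subst₂ _<_ (sym (toℕ-cast (sym e) i)) (sym (toℕ-cast (sym e) j)) i<j)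

  values' : ∀ k → x (h (back k)) ≡ just (w k)
  values' k = begin
    x (h (back k))             ≡⟨ values (back k) ⟩
    just (v (back k))          ≡⟨ cong just (w∘cast≗v (back k)) ⟨
    just (w (cast e (back k))) ≡⟨ cong (just ∘ w) (cast-involutive e (sym e) k) ⟩
    just (w k)                 ∎
    where open ≡-Reasoning

  gaps' : ∀ m → (∀ k → h (back k) ≢ m) → x m ≡ nothing
  gaps' m missed = gaps m λ k hk≡m →
    missed (cast e k) (trans (cong h (cast-involutive (sym e) e k)) hk≡m)

Filter-mapSeq : ∀ {X Y : Set} (f : X → Y) {x : ℕ → Maybe X} {x' : ℕ → Maybe Y} →
  (∀ i → x' i ≡ mapMaybe f (x i)) → ∀ δ → Filter x δ → Filter x' (mapSeq f δ)
Filter-mapSeq f x'≡fx (infSeq g) filtered = FilterBy-map f x'≡fx filtered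
Filter-mapSeq f x'≡fx (finSeq a as) filtered =
  FilterBy-cast (sym (length-map f (a ∷ as))) (lookup-map f (a ∷ as))
    (FilterBy-map f x'≡fx filtered)

Filter-unmapSeq : ∀ {X Y : Set} (g : Y → X) {y : ℕ → Maybe X} {y' : ℕ → Maybe Y} →
  (∀ i → y i ≡ mapMaybe g (y' i)) → ∀ δ → Filter y δ →
  ∃ λ δ' → Filter y' δ' × mapSeq g δ' ≈ˢ δ
Filter-unmapSeq g y≡gy' (infSeq _) filtered with FilterBy-unmap g y≡gy' filtered
... | v' , filtered' , gv'≗v = infSeq v' , filtered' , gv'≗v
Filter-unmapSeq g y≡gy' (finSeq a as) filtered with FilterBy-unmap g y≡gy' filtered
... | v' , filtered' , gv'≗v =
  finSeq (v' fzero) (tabulate (v' ∘ fsuc)) ,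
  FilterBy-cast (sym (length-tabulate v')) (lookup-tabulate v') filtered' ,
  trans (map-tabulate v' g) (trans (tabulate-cong gv'≗v) (tabulate-lookup (a ∷ as)))

strictly-monotone-≤-last : ∀ {n} (h : Fin (suc n) → ℕ) →
  (∀ i j → i <ᶠ j → h i < h j) → ∀ k → h k ≤ h (fromℕ n)
strictly-monotone-≤-last h mono k with m≤n⇒m<n∨m≡n (≤fromℕ k)
... | inj₁ k<last = <⇒≤ (mono k _ k<last)
... | inj₂ k≡last = ≤-reflexive (cong h (toℕ-injective k≡last))

module _ (A : ProtoAlg) where

  outputsL-nonempty : ∀ {s τ} → FinRun A s τ → ∃₂ λ y ys → outputsL A s τ ≡ y ∷ ys
  outputsL-nonempty {finalS y} {[]} tt = y , [] , refl
  outputsL-nonempty {s} {t ∷ τ} (_ , _ , run) with doutOf A s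
  ... | just y = y , outputsL A t τ , refl
  ... | nothing = outputsL-nonempty {t} {τ} run

  internal-if-no-input : ∀ s → dinOf A s ≡ nothing → ¬ IsFinal A s → IsInternal A s
  internal-if-no-input (finalS _) _ nonfinal = ⊥-elim (nonfinal tt)
  internal-if-no-input (internalS _ _ _) _ _ = tt

  infinite-run-with-finite-inputs-diverges : ∀ {σ x xs} → (∀ i → ¬ IsFinal A (σ i)) →
    Inputs A (infSeq σ) (finSeq x xs) → Divergent A (infSeq σ)
  infinite-run-with-finite-inputs-diverges {σ} nonfinal (h , mono , _ , gaps) =
    suc (h (fromℕ _)) , λ j last<j →
      internal-if-no-input (σ j) (gaps j (λ k hk≡j →
        <-irrefl hk≡j (≤-trans (s≤s (strictly-monotone-≤-last h mono k)) last<j)))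
      (nonfinal j)

module _ {S S' : Set} {R : S → S' → Set} {_⟶_ : S → S → Set} {_⟶'_ : S' → S' → Set}
         (simulate : ∀ {s s'} → R s s' → ∀ {t} → s ⟶ t → ∃ λ t' → s' ⟶' t' × R t t') where

  lift-chain : (σ : ℕ → S) → (∀ i → σ i ⟶ σ (suc i)) → ∀ {s₀'} → R (σ 0) s₀' →
    Σ (ℕ → S') λ σ' → σ' 0 ≡ s₀' × (∀ i → σ' i ⟶' σ' (suc i)) × (∀ i → R (σ i) (σ' i))
  lift-chain σ steps {s₀'} r₀ =
    proj₁ ∘ lifted , refl , (λ i → proj₁ (proj₂ (simulate (proj₂ (lifted i)) (steps i)))) ,
    proj₂ ∘ lifted
    where
    lifted : ∀ i → Σ S' (R (σ i))
    lifted zero = s₀' , r₀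
    lifted (suc i) = let (t' , _ , r) = simulate (proj₂ (lifted i)) (steps i) in t' , r

module Simulation {A A' : ProtoAlg} (sim : AlgSimulation A A') where
  open AlgSimulation sim

  din-related : ∀ {s s'} → R s s' → dinOf A' s' ≡ mapMaybe gI (dinOf A s)
  din-related r = ≡-mapMaybe gI (gI-rel _ _ r)

  dout-related : ∀ {s s'} → R s s' → doutOf A s ≡ mapMaybe gO (doutOf A' s')
  dout-related r = ≡-mapMaybe gO (gO-rel _ _ r ∘ swap)

  internal-reflected : ∀ {s s'} → R s s' → IsInternal A' s' → IsInternal A s
  internal-reflected r = from (kind-internal _ _ r)

  initialS-related : ∀ x → R (initialS x) (initialS (gI x))
  initialS-related x with init-rel x
  ... | initialS _ , _ , r = subst (R (initialS x)) (cong initialS (just-injective (din-related r))) r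
  ... | finalS _ , () , _
  ... | internalS _ _ _ , () , _
  ... | interactionS _ _ _ _ _ , () , _

  lift-FinRun : ∀ {s s' τ} → R s s' → FinRun A s τ →
    ∃ λ τ' → FinRun A' s' τ' × Pointwise R (s ∷ τ) (s' ∷ τ')
  lift-FinRun {τ = []} r final = [] , to (kind-final _ _ r) final , r ∷ []
  lift-FinRun {s} {s'} {t ∷ τ} r (nonfinal , step , run) with step-rel s s' r t step
  ... | t' , step' , r' with lift-FinRun r' run
  ... | τ' , run' , rs = t' ∷ τ' , (nonfinal ∘ from (kind-final _ _ r) , step' , run') , r ∷ rs

  inputsL-related : ∀ {s τ s' τ'} → Pointwise R (s ∷ τ) (s' ∷ τ') →
    inputsL A' s' τ' ≡ map gI (inputsL A s τ)
  inputsL-related (r ∷ []) = refl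
  inputsL-related {s} {t ∷ τ} (r ∷ rs@(_ ∷ _)) =
    trans (cong₂ maybeCons (din-related r) (inputsL-related rs))
      (maybeCons-map gI (dinOf A s) (inputsL A t τ))

  outputsL-related : ∀ {s τ s' τ'} → Pointwise R (s ∷ τ) (s' ∷ τ') →
    outputsL A s τ ≡ map gO (outputsL A' s' τ')
  outputsL-related {s' = s'} (r ∷ []) =
    trans (cong (λ m → maybeCons m []) (dout-related r)) (maybeCons-map gO (doutOf A' s') [])
  outputsL-related {s' = s'} {t' ∷ τ'} (r ∷ rs@(_ ∷ _)) =
    trans (cong₂ maybeCons (dout-related r) (outputsL-related rs))
      (maybeCons-map gO (doutOf A' s') (outputsL A' t' τ'))

  All-internal-reflected : ∀ {ss ss'} → Pointwise R ss ss' →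
    All (IsInternal A') ss' → All (IsInternal A) ss
  All-internal-reflected [] [] = []
  All-internal-reflected (r ∷ rs) (i ∷ is) = internal-reflected r i ∷ All-internal-reflected rs is

  DivergentL-reflected : ∀ {s τ s' τ'} → Pointwise R (s ∷ τ) (s' ∷ τ') →
    DivergentL A' s' τ' → DivergentL A s τ
  DivergentL-reflected (r ∷ []) internal = internal-reflected r internal
  DivergentL-reflected (r ∷ rs@(_ ∷ _)) (inj₁ (internal , internals)) =
    inj₁ (internal-reflected r internal , All-internal-reflected rs internals)
  DivergentL-reflected (r ∷ rs@(_ ∷ _)) (inj₂ divergent) = inj₂ (DivergentL-reflected rs divergent)

  Divergent-infinite-reflected : ∀ {σ σ'} → (∀ i → R (σ i) (σ' i)) →
    Divergent A' (infSeq σ') → Divergent A (infSeq σ)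
  Divergent-infinite-reflected rel (i , internal) =
    i , λ j i≤j → internal-reflected (rel j) (internal j i≤j)

  lift-finite-ARun : ∀ {x xs s τ} → ARun A (finSeq x xs) (finSeq s τ) → Convergent A (finSeq s τ) →
    ∃₂ λ s' τ' → ARun A' (mapSeq gI (finSeq x xs)) (finSeq s' τ') × Convergent A' (finSeq s' τ')
               × Pointwise R (s ∷ τ) (s' ∷ τ')
  lift-finite-ARun {τ = τ} ((refl , run) , inputs) convergent
    with lift-FinRun {τ = τ} (initialS-related _) run
  ... | τ' , run' , rs =
    _ , τ' , ((refl , run') , trans (inputsL-related rs) (cong (map gI) inputs)) ,
    convergent ∘ DivergentL-reflected rs , rs

  lift-infinite-run : ∀ {σ} δ → IsSemiRun A (initialS (headSeq δ)) (infSeq σ) →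
    Σ (ℕ → State A') λ σ' → IsSemiRun A' (initialS (headSeq (mapSeq gI δ))) (infSeq σ')
                          × (∀ i → R (σ i) (σ' i))
  lift-infinite-run {σ} δ (σ₀≡init , steps) =
    let (σ' , σ'₀≡init , steps' , rel) =
          lift-chain {R = R} {AStep A} {AStep A'} (λ r {t} → step-rel _ _ r t) σ (proj₂ ∘ steps) r₀
    in σ' , (σ'₀≡init , λ i → proj₁ (steps i) ∘ from (kind-final _ _ (rel i)) , steps' i) , rel
    where
    r₀ : R (σ 0) (initialS (headSeq (mapSeq gI δ)))
    r₀ = subst₂ R (sym σ₀≡init) (cong initialS (sym (headSeq-mapSeq gI δ)))
           (initialS-related (headSeq δ))

  Computes-simulated : ∀ δin δout → Computes A δin δout →
    ∃ λ δout' → Computes A' (mapSeq gI δin) δout' × mapSeq gO δout' ≈ˢ δout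
  Computes-simulated (finSeq x xs) (finSeq y ys) (finSeq s τ , run , convergent , outputs)
    with lift-finite-ARun {τ = τ} run convergent
  ... | s' , τ' , run' , convergent' , rs with outputsL-nonempty A' {s'} {τ'} (proj₂ (proj₁ run'))
  ... | y' , ys' , outputs' =
    finSeq y' ys' , (finSeq s' τ' , run' , convergent' , outputs') , (begin
      map gO (y' ∷ ys')             ≡⟨ cong (map gO) outputs' ⟨
      map gO (outputsL A' s' τ')    ≡⟨ outputsL-related rs ⟨
      outputsL A s τ                ≡⟨ outputs ⟩
      y ∷ ys                        ∎)
    where open ≡-Reasoning
  Computes-simulated (finSeq _ _) (infSeq _) (finSeq _ _ , _ , _ , ())
  Computes-simulated (infSeq _) _ (finSeq _ _ , (_ , ()) , _ , _)
  Computes-simulated δin δout (infSeq σ , (semirun , inputs) , convergent , outputs) =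
    let (σ' , semirun' , rel) = lift-infinite-run δin semirun
        (δout' , outputs' , mapped) = Filter-unmapSeq gO (dout-related ∘ rel) δout outputs
    in δout' ,
       (infSeq σ' , (semirun' , Filter-mapSeq gI (din-related ∘ rel) δin inputs) ,
        convergent ∘ Divergent-infinite-reflected rel , outputs') ,
       mapped

  finite-ARun-simulated : ∀ x (xs : List (Interp.Din (ProtoAlg.𝓘 A))) σ →
    ARun A (finSeq x xs) σ → Convergent A σ →
    ∃ λ σ' → Convergent A' σ' × ARun A' (mapSeq gI (finSeq x xs)) σ'
      × (∃ λ δo → Outputs A σ δo
          × ∃ λ δo' → Outputs A' σ' δo' × mapSeq gO δo' ≈ˢ δo)
      × SameLength σ σ'
  finite-ARun-simulated x xs (finSeq s τ) run convergent with lift-finite-ARun {τ = τ} run convergent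
  ... | s' , τ' , run' , convergent' , rs with outputsL-nonempty A' {s'} {τ'} (proj₂ (proj₁ run'))
  ... | y' , ys' , outputs' =
    finSeq s' τ' , convergent' , run' ,
    (finSeq (gO y') (map gO ys') , trans (outputsL-related rs) (cong (map gO) outputs') ,
     finSeq y' ys' , outputs' , refl) ,
    suc-injective (Pointwise-length rs)
  finite-ARun-simulated x xs (infSeq σ) ((_ , steps) , inputs) convergent =
    ⊥-elim (convergent (infinite-run-with-finite-inputs-diverges A (proj₁ ∘ steps) inputs))

theorem3 : (A A' : ProtoAlg) → SimulatedBy A A' →
    Σ (Interp.Din (ProtoAlg.𝓘 A) → Interp.Din (ProtoAlg.𝓘 A')) λ fI →
    Σ (Interp.Dout (ProtoAlg.𝓘 A') → Interp.Dout (ProtoAlg.𝓘 A)) λ fO →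
      (∀ δin δout → Computes A δin δout →
         ∃ λ δout' → Computes A' (mapSeq fI δin) δout' × mapSeq fO δout' ≈ˢ δout)
      × (∀ x (xs : List (Interp.Din (ProtoAlg.𝓘 A))) σ →
           ARun A (finSeq x xs) σ → Convergent A σ →
           ∃ λ σ' → Convergent A' σ' × ARun A' (mapSeq fI (finSeq x xs)) σ'
             × (∃ λ δo → Outputs A σ δo
                 × ∃ λ δo' → Outputs A' σ' δo' × mapSeq fO δo' ≈ˢ δo)
             × SameLength σ σ')
theorem3 A A' sim = gI , gO , Computes-simulated , finite-ARun-simulated
  where
  open AlgSimulation sim
  open Simulation sim
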